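{- For all positive integers $n$ and $m$ with $3 \leq m \leq n$, $$\rho\hat{\;}(\mathbb{Z}_n,m,2) \leq \begin{cases} \min\{\rho(\mathbb{Z}_n,m,2),\, 2m-4\} & \text{if } 2\mid n \text{ and } 2\mid m, \text{ or } (2m-2)\mid n \text{ and } m \text{ is not of the form } 2^k+1 \ (k\in\mathbb{N}),\\ \min\{\rho(\mathbb{Z}_n,m,2),\, 2m-3\} & \text{otherwise.}\end{cases}$$
   Context: For a subset $A$ of $\mathbb{Z}_n$, $2A$ is the set of sums $a+b$ with $a,b\in A$ (not necessarily distinct), and $2\hat{\;}A$ is the set of sums $a+b$ with $a,b\in A$, $a\ne b$. $\rho(\mathbb{Z}_n,m,2) = \min\{|2A| : A\subseteq\mathbb{Z}_n, |A|=m\}$ and $\rho\hat{\;}(\mathbb{Z}_n,m,2) = \min\{|2\hat{\;}A| : A\subseteq\mathbb{Z}_n, |A|=m\}$. -}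

module Defs where

open import Data.Bool using (Bool; true; false; _∧_; not)
open import Data.Nat using (ℕ; zero; suc; _+_; _*_; _∸_; _^_; _⊓_)
open import Data.Nat.DivMod using (_mod_)
open import Data.Fin using (Fin; toℕ; _≟_)
open import Data.Fin.Subset using (Subset; ∣_∣)
open import Data.Vec using (Vec; []; _∷_; lookup; tabulate)
open import Data.List using (List; []; _∷_; _++_; map; allFin; filter; foldr)
open import Data.Bool.ListAction using (any)
open import Relation.Nullary.Decidable using (⌊_⌋)
open import Relation.Binary.PropositionalEquality using (_≡_)
import Data.Nat as N

_⊕_ : ∀ {n} → Fin n → Fin n → Fin n
_⊕_ {zero} () _
_⊕_ {suc k} a b = (toℕ a + toℕ b) mod suc k

sumset : ∀ {n} → Subset n → Subset n
sumset {n} A = tabulate λ c →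
  any (λ a → any (λ b → lookup A a ∧ lookup A b ∧ ⌊ (a ⊕ b) ≟ c ⌋) (allFin n)) (allFin n)

restrictedSumset : ∀ {n} → Subset n → Subset n
restrictedSumset {n} A = tabulate λ c →
  any (λ a → any (λ b → lookup A a ∧ lookup A b ∧ not ⌊ a ≟ b ⌋ ∧ ⌊ (a ⊕ b) ≟ c ⌋) (allFin n)) (allFin n)

allSubsets : ∀ n → List (Subset n)
allSubsets zero = [] ∷ []
allSubsets (suc n) = map (true ∷_) (allSubsets n) ++ map (false ∷_) (allSubsets n)

subsetsOfSize : ∀ n → ℕ → List (Subset n)
subsetsOfSize n m = filter (λ A → ∣ A ∣ N.≟ m) (allSubsets n)

-- minimum of a list (0 for the empty list; never used on empty lists here)
minimum : List ℕ → ℕ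
minimum [] = 0
minimum (x ∷ xs) = foldr _⊓_ x xs

ρ : ℕ → ℕ → ℕ
ρ n m = minimum (map (λ A → ∣ sumset A ∣) (subsetsOfSize n m))

ρ^ : ℕ → ℕ → ℕ
ρ^ n m = minimum (map (λ A → ∣ restrictedSumset A ∣) (subsetsOfSize n m))

module Submission where

open import Defs
open import Data.Nat using (ℕ; _+_; _*_; _∸_; _^_; _≤_; _⊓_)
open import Data.Nat.Divisibility using (_∣_)
open import Data.Product using (_×_; ∃)
open import Data.Sum using (_⊎_)
open import Relation.Nullary using (¬_)
open import Relation.Binary.PropositionalEquality using (_≡_)

open import Data.Nat using (zero; suc; _<_; _≤?_; _<?_; z≤n; s≤s; z<s; NonZero; >-nonZero; >-nonZero⁻¹; ≢-nonZero⁻¹)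
open import Data.Nat.Properties
open import Data.Nat.DivMod
  using (_%_; _/_; [m+n]%n≡m%n; [m+kn]%n≡m%n; m*n%n≡0; m<n⇒m%n≡m; m≡m%n+[m/n]*n; m%n<n; m<n*o⇒m/o<n; %-congʳ; m%n*o≡m*o%[n*o])
open import Data.Nat.Divisibility using (divides)
open import Data.Nat.Induction using (<-rec)
open import Data.Nat.Tactic.RingSolver using (solve-∀)
open import Data.Bool using (Bool; true; false; T; _∧_)
open import Data.Bool.Properties using (T-∧; T-≡)
open import Data.Fin using (Fin; toℕ) renaming (_≟_ to _≟ᶠ_)
open import Data.Fin.Properties using (toℕ-fromℕ<; toℕ<n; toℕ-injective)
open import Data.Fin.Subset using (Subset; ∣_∣; _⊆_; ∁; ⊥) renaming (_∈_ to _∈ₛ_)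
open import Data.Fin.Subset.Properties using (∣⊥∣≡0; ∉⊥; p⊆q⇒∣p∣≤∣q∣; x∈∁p⇒x∉p; ∣∁p∣≡n∸∣p∣; ∣p∣≤n)
open import Data.Vec using (_∷_; []; here; there; lookup; tabulate)
open import Data.Vec.Properties using (lookup∘tabulate; lookup⇒[]=; []=⇒lookup)
open import Data.List using (List; []; _∷_; _++_; map; allFin; length; foldr; applyUpTo)
open import Data.List.Properties using (length-applyUpTo; length-map; length-++)
open import Data.List.Membership.Propositional using (_∈_; lose)
open import Data.List.Membership.Propositional.Properties using (∈-filter⁺; ∈-map⁺; ∈-++⁺ˡ; ∈-++⁺ʳ; ∈-allFin; ∈-applyUpTo⁺)
open import Data.List.Relation.Unary.Any using (here; there; satisfied)
open import Data.List.Relation.Unary.Any.Properties using (any⁺; any⁻)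
open import Data.Product using (∃₂; _,_)
open import Data.Sum using (inj₁; inj₂)
open import Data.Empty using (⊥-elim)
open import Function using (_∘_)
open import Function.Bundles using (module Equivalence)
open import Relation.Nullary using (yes; no)
open import Relation.Nullary.Decidable using (⌊_⌋; toWitness; toWitnessFalse; fromWitness; _⊎-dec_; _×-dec_)
open import Relation.Unary using (Decidable)
open import Relation.Binary.Definitions using (tri<; tri≈; tri>)
open import Relation.Binary.PropositionalEquality using (_≢_; refl; sym; trans; cong; cong₂; subst; subst₂; module ≡-Reasoning)

open Equivalence using (to; from)

-- Since 2^A ⊆ 2A, ρ^ ≤ ρ, and each remaining bound is witnessed by an explicit set A ⊆ ℤ_n of
-- size m. For A = {0, …, m − 1}, 2^A ⊆ [1, 2m − 3]. For n = 2h and m = 2j, A = [0, j) ∪ [h, h + j)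
-- has 2^A ⊆ [1, 2j − 3] ∪ [h, h + 2j − 2] because h + h ≡ 0. If m is not of the form 2^k + 1, then
-- m − 1 = hq with q ≥ 3 odd, and some A ⊆ ℤ_{2hq} of size m has neither 0 nor 2h in 2^A; when
-- (2m − 2) ∣ n, multiplication by n / (2m − 2) carries A into ℤ_n.

shiftDown : List ℕ → List ℕ
shiftDown [] = []
shiftDown (zero ∷ xs) = shiftDown xs
shiftDown (suc x ∷ xs) = x ∷ shiftDown xs

length-shiftDown≤ : ∀ xs → length (shiftDown xs) ≤ length xs
length-shiftDown≤ [] = z≤n
length-shiftDown≤ (zero ∷ xs) = m≤n⇒m≤1+n (length-shiftDown≤ xs)
length-shiftDown≤ (suc x ∷ xs) = s≤s (length-shiftDown≤ xs)

length-shiftDown< : ∀ {xs} → 0 ∈ xs → length (shiftDown xs) < length xs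
length-shiftDown< {zero ∷ xs} _ = s≤s (length-shiftDown≤ xs)
length-shiftDown< {suc x ∷ xs} (there 0∈xs) = s≤s (length-shiftDown< 0∈xs)

∈-shiftDown⁺ : ∀ {x xs} → suc x ∈ xs → x ∈ shiftDown xs
∈-shiftDown⁺ {xs = zero ∷ xs} (there x∈xs) = ∈-shiftDown⁺ x∈xs
∈-shiftDown⁺ {xs = suc y ∷ xs} (here refl) = here refl
∈-shiftDown⁺ {xs = suc y ∷ xs} (there x∈xs) = there (∈-shiftDown⁺ x∈xs)

interval : ℕ → ℕ → List ℕ
interval lo len = applyUpTo (lo +_) len

length-interval : ∀ lo len → length (interval lo len) ≡ len
length-interval lo = length-applyUpTo (lo +_)

∈-interval⁺ : ∀ {lo len x} → lo ≤ x → x < lo + len → x ∈ interval lo len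
∈-interval⁺ {lo} {len} {x} lo≤x x<lo+len = subst (_∈ interval lo len) (m+[n∸m]≡n lo≤x)
  (∈-applyUpTo⁺ (lo +_) (+-cancelˡ-< lo _ _ (subst (_< lo + len) (sym (m+[n∸m]≡n lo≤x)) x<lo+len)))

blocks : ℕ → List ℕ → ℕ → List ℕ
blocks d rs zero = []
blocks d rs (suc k) = map (_+ k * d) rs ++ blocks d rs k

length-blocks : ∀ d rs k → length (blocks d rs k) ≡ k * length rs
length-blocks d rs zero = refl
length-blocks d rs (suc k) =
  trans (length-++ (map (_+ k * d) rs)) (cong₂ _+_ (length-map (_+ k * d) rs) (length-blocks d rs k))

∈-blocks⁺ : ∀ {d rs k r j} → r ∈ rs → j < k → r + j * d ∈ blocks d rs k
∈-blocks⁺ {d} {rs} {suc k} {j = j} r∈rs j<1+k with j ≟ k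
... | yes refl = ∈-++⁺ˡ (∈-map⁺ (_+ k * d) r∈rs)
... | no j≢k = ∈-++⁺ʳ (map (_+ k * d) rs) (∈-blocks⁺ r∈rs (≤∧≢⇒< (≤-pred j<1+k) j≢k))

∣p∣≤length : ∀ {n} (p : Subset n) (xs : List ℕ) → (∀ {x} → x ∈ₛ p → toℕ x ∈ xs) → ∣ p ∣ ≤ length xs
∣p∣≤length [] xs _ = z≤n
∣p∣≤length (true ∷ p) xs p⊆xs = begin-strict
  ∣ p ∣                  ≤⟨ ∣p∣≤length p (shiftDown xs) (∈-shiftDown⁺ ∘ p⊆xs ∘ there) ⟩
  length (shiftDown xs)  <⟨ length-shiftDown< (p⊆xs here) ⟩
  length xs              ∎
  where open ≤-Reasoning
∣p∣≤length (false ∷ p) xs p⊆xs =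
  ≤-trans (∣p∣≤length p (shiftDown xs) (∈-shiftDown⁺ ∘ p⊆xs ∘ there)) (length-shiftDown≤ xs)

⊆-ofSize : ∀ {n} m (p : Subset n) → m ≤ ∣ p ∣ → ∃ λ q → q ⊆ p × ∣ q ∣ ≡ m
⊆-ofSize {n} zero p _ = ⊥ , (λ x∈⊥ → ⊥-elim (∉⊥ x∈⊥)) , ∣⊥∣≡0 n
⊆-ofSize (suc m) (true ∷ p) (s≤s m≤∣p∣) with ⊆-ofSize m p m≤∣p∣
... | q , q⊆p , ∣q∣≡m = true ∷ q , (λ { here → here ; (there x∈q) → there (q⊆p x∈q) }) , cong suc ∣q∣≡m
⊆-ofSize (suc m) (false ∷ p) m<∣p∣ with ⊆-ofSize (suc m) p m<∣p∣
... | q , q⊆p , ∣q∣≡m = false ∷ q , (λ { (there x∈q) → there (q⊆p x∈q) }) , ∣q∣≡m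

∈ₛ⇒T : ∀ {n} {p : Subset n} {x} → x ∈ₛ p → T (lookup p x)
∈ₛ⇒T x∈p = from T-≡ ([]=⇒lookup x∈p)

T⇒∈ₛ : ∀ {n} {p : Subset n} {x} → T (lookup p x) → x ∈ₛ p
T⇒∈ₛ {p = p} {x} t = lookup⇒[]= x p (to T-≡ t)

∈-tabulate⁻ : ∀ {n} {f : Fin n → Bool} {x} → x ∈ₛ tabulate f → T (f x)
∈-tabulate⁻ {f = f} {x} x∈ = subst T (lookup∘tabulate f x) (∈ₛ⇒T x∈)

∈-tabulate⁺ : ∀ {n} {f : Fin n → Bool} {x} → T (f x) → x ∈ₛ tabulate f
∈-tabulate⁺ {f = f} {x} t = T⇒∈ₛ (subst T (sym (lookup∘tabulate f x)) t)

-- Restricted sumsets and ρ^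

∈-restrictedSumset⁻ : ∀ {n} {A : Subset n} {c} → c ∈ₛ restrictedSumset A →
  ∃₂ λ a b → a ∈ₛ A × b ∈ₛ A × a ≢ b × a ⊕ b ≡ c
∈-restrictedSumset⁻ {n} {A} {c} c∈
  with a , ∃b ← satisfied (any⁻ _ (allFin n) (∈-tabulate⁻ c∈))
  with b , t ← satisfied (any⁻ _ (allFin n) ∃b)
  with a∈A , t ← to T-∧ t
  with b∈A , t ← to T-∧ t
  with a≢b , a⊕b≡c ← to T-∧ t
  = a , b , T⇒∈ₛ a∈A , T⇒∈ₛ b∈A , toWitnessFalse {a? = a ≟ᶠ b} a≢b , toWitness {a? = a ⊕ b ≟ᶠ c} a⊕b≡c

∈-sumset⁺ : ∀ {n} {A : Subset n} {a b} → a ∈ₛ A → b ∈ₛ A → a ⊕ b ∈ₛ sumset A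
∈-sumset⁺ {A = A} {a} {b} a∈A b∈A =
  ∈-tabulate⁺ (any⁺ _ (lose (∈-allFin a) (any⁺ _ (lose (∈-allFin b) a,b∈A))))
  where
  a,b∈A : T (lookup A a ∧ lookup A b ∧ ⌊ a ⊕ b ≟ᶠ a ⊕ b ⌋)
  a,b∈A = from T-∧ (∈ₛ⇒T a∈A , from T-∧ (∈ₛ⇒T b∈A , fromWitness {a? = a ⊕ b ≟ᶠ a ⊕ b} refl))

restrictedSumset⊆sumset : ∀ {n} (A : Subset n) → restrictedSumset A ⊆ sumset A
restrictedSumset⊆sumset A c∈ =
  let a , b , a∈A , b∈A , _ , a⊕b≡c = ∈-restrictedSumset⁻ {A = A} c∈
  in subst (_∈ₛ sumset A) a⊕b≡c (∈-sumset⁺ {A = A} a∈A b∈A)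

toℕ-⊕ : ∀ {n} .{{_ : NonZero n}} (a b : Fin n) → toℕ (a ⊕ b) ≡ (toℕ a + toℕ b) % n
toℕ-⊕ {suc k} a b = toℕ-fromℕ< _

minimum≤ : ∀ {xs y} → y ∈ xs → minimum xs ≤ y
minimum≤ {x ∷ xs} (here refl) = foldr-⊓≤init xs
  where
  foldr-⊓≤init : ∀ ys → foldr _⊓_ x ys ≤ x
  foldr-⊓≤init [] = ≤-refl
  foldr-⊓≤init (y ∷ ys) = ≤-trans (m⊓n≤n y _) (foldr-⊓≤init ys)
minimum≤ {x ∷ xs} (there y∈xs) = foldr-⊓≤∈ y∈xs
  where
  foldr-⊓≤∈ : ∀ {ys y} → y ∈ ys → foldr _⊓_ x ys ≤ y
  foldr-⊓≤∈ {z ∷ zs} (here refl) = m⊓n≤m z _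
  foldr-⊓≤∈ {z ∷ zs} (there y∈zs) = ≤-trans (m⊓n≤n z _) (foldr-⊓≤∈ y∈zs)

minimum-mono : ∀ {B : Set} {f g : B → ℕ} → (∀ x → f x ≤ g x) → ∀ xs →
  minimum (map f xs) ≤ minimum (map g xs)
minimum-mono f≤g [] = z≤n
minimum-mono {f = f} {g} f≤g (x ∷ xs) = foldr-mono (f≤g x) xs
  where
  foldr-mono : ∀ {a b} → a ≤ b → ∀ ys → foldr _⊓_ a (map f ys) ≤ foldr _⊓_ b (map g ys)
  foldr-mono a≤b [] = a≤b
  foldr-mono a≤b (y ∷ ys) = ⊓-mono-≤ (f≤g y) (foldr-mono a≤b ys)

∈-allSubsets : ∀ {n} (p : Subset n) → p ∈ allSubsets n
∈-allSubsets [] = here refl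
∈-allSubsets {suc n} (true ∷ p) = ∈-++⁺ˡ (∈-map⁺ (true ∷_) (∈-allSubsets p))
∈-allSubsets {suc n} (false ∷ p) =
  ∈-++⁺ʳ (map (true ∷_) (allSubsets n)) (∈-map⁺ (false ∷_) (∈-allSubsets p))

ρ^≤ρ : ∀ n m → ρ^ n m ≤ ρ n m
ρ^≤ρ n m = minimum-mono (λ A → p⊆q⇒∣p∣≤∣q∣ (restrictedSumset⊆sumset A)) (subsetsOfSize n m)

ρ^≤∣restrictedSumset∣ : ∀ {n m} (A : Subset n) → ∣ A ∣ ≡ m → ρ^ n m ≤ ∣ restrictedSumset A ∣
ρ^≤∣restrictedSumset∣ {n} {m} A ∣A∣≡m =
  minimum≤ (∈-map⁺ (λ B → ∣ restrictedSumset B ∣) (∈-filter⁺ (λ B → ∣ B ∣ ≟ m) (∈-allSubsets A) ∣A∣≡m))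

-- A set A ⊆ ℤ_n, given by a decidable predicate on the representatives 0, …, n − 1, with at least
-- m elements (its complement is covered by nonMembers) and with 2^A covered by the residues in sums.
record Certificate (n : ℕ) {{_ : NonZero n}} (m ℓ : ℕ) : Set₁ where
  field
    Member : ℕ → Set
    member? : Decidable Member
    nonMembers : List ℕ
    nonMembers-complete : ∀ {x} → x < n → ¬ Member x → x ∈ nonMembers
    m+nonMembers≤n : m + length nonMembers ≤ n
    sums : List ℕ
    sums-complete : ∀ {x y} → x < n → y < n → Member x → Member y → x ≢ y → (x + y) % n ∈ sums
    length-sums≤ℓ : length sums ≤ ℓ

-- NonZero n is taken from the type of C by unification: instance search cannot find it for moduli
-- such as t * N.
module _ {n m ℓ} {n≢0 : NonZero n} (C : Certificate n {{n≢0}} m ℓ) where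
  private instance _ = n≢0
  open Certificate C
  open ≤-Reasoning

  carrier : Subset n
  carrier = tabulate (λ x → ⌊ member? (toℕ x) ⌋)

  ∈-carrier⁻ : ∀ {x} → x ∈ₛ carrier → Member (toℕ x)
  ∈-carrier⁻ x∈A = toWitness (∈-tabulate⁻ x∈A)

  m≤∣carrier∣ : m ≤ ∣ carrier ∣
  m≤∣carrier∣ = begin
    m                           ≤⟨ m+n≤o⇒m≤o∸n m m+nonMembers≤n ⟩
    n ∸ length nonMembers       ≤⟨ ∸-monoʳ-≤ n ∣∁carrier∣≤ ⟩
    n ∸ (n ∸ ∣ carrier ∣)       ≡⟨ m∸[m∸n]≡n (∣p∣≤n carrier) ⟩
    ∣ carrier ∣                 ∎
    where
    ∣∁carrier∣≤ : n ∸ ∣ carrier ∣ ≤ length nonMembers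
    ∣∁carrier∣≤ = subst (_≤ length nonMembers) (∣∁p∣≡n∸∣p∣ carrier) (∣p∣≤length (∁ carrier) nonMembers
      λ {x} x∈∁A → nonMembers-complete (toℕ<n x) λ x∈ → x∈∁p⇒x∉p x∈∁A (∈-tabulate⁺ (fromWitness x∈)))

  toℕ-restrictedSumset⊆sums : ∀ {B} → B ⊆ carrier → ∀ {c} → c ∈ₛ restrictedSumset B → toℕ c ∈ sums
  toℕ-restrictedSumset⊆sums {B} B⊆A c∈ =
    let a , b , a∈B , b∈B , a≢b , a⊕b≡c = ∈-restrictedSumset⁻ {A = B} c∈
    in subst (_∈ sums) (trans (sym (toℕ-⊕ a b)) (cong toℕ a⊕b≡c))
         (sums-complete (toℕ<n a) (toℕ<n b) (∈-carrier⁻ (B⊆A a∈B)) (∈-carrier⁻ (B⊆A b∈B)) (a≢b ∘ toℕ-injective))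

  ρ^≤ℓ : ρ^ n m ≤ ℓ
  ρ^≤ℓ = let B , B⊆A , ∣B∣≡m = ⊆-ofSize m carrier m≤∣carrier∣ in begin
    ρ^ n m                   ≤⟨ ρ^≤∣restrictedSumset∣ B ∣B∣≡m ⟩
    ∣ restrictedSumset B ∣   ≤⟨ ∣p∣≤length (restrictedSumset B) sums (toℕ-restrictedSumset⊆sums B⊆A) ⟩
    length sums              ≤⟨ length-sums≤ℓ ⟩
    ℓ                        ∎

m+m≡2m : ∀ m → m + m ≡ 2 * m
m+m≡2m = solve-∀

∸-≡ : ∀ a c {b} → b ≡ a + c → b ∸ c ≡ a
∸-≡ a c refl = m+n∸n≡m a c

m<n+n∧m%n≡r⇒m≡r⊎m≡n+r : ∀ {m n r} .{{_ : NonZero n}} → m < n + n → m % n ≡ r → m ≡ r ⊎ m ≡ n + r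
m<n+n∧m%n≡r⇒m≡r⊎m≡n+r {m} {n} {r} m<n+n m%n≡r
  with m / n | m≡m%n+[m/n]*n m n | m<n*o⇒m/o<n {m} {2} {n} (subst (m <_) (cong (n +_) (sym (+-identityʳ n))) m<n+n)
... | zero | m≡ | _ = inj₁ (trans m≡ (trans (+-identityʳ (m % n)) m%n≡r))
... | suc zero | m≡ | _ = inj₂ (trans m≡ (trans (cong₂ _+_ m%n≡r (+-identityʳ n)) (+-comm r n)))
... | suc (suc _) | _ | s≤s (s≤s ())

≥-pinch : ∀ {a b c} → c ≤ a → c ≤ b → a + b ≤ c + c → a ≡ c × b ≡ c
≥-pinch {a} {b} {c} c≤a c≤b a+b≤c+c =
  ≤-antisym (+-cancelʳ-≤ c a c (≤-trans (+-monoʳ-≤ a c≤b) a+b≤c+c)) c≤a ,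
  ≤-antisym (+-cancelˡ-≤ c b c (≤-trans (+-monoˡ-≤ b c≤a) a+b≤c+c)) c≤b

≤-pinch : ∀ {a b c} → a ≤ c → b ≤ c → c + c ≤ a + b → a ≡ c × b ≡ c
≤-pinch {a} {b} {c} a≤c b≤c c+c≤a+b =
  ≤-antisym a≤c (+-cancelʳ-≤ c c a (≤-trans c+c≤a+b (+-monoʳ-≤ a b≤c))) ,
  ≤-antisym b≤c (+-cancelˡ-≤ c c b (≤-trans c+c≤a+b (+-monoˡ-≤ b a≤c)))

<-sum∈interval : ∀ {a b m} → a < b → b < m → a + b ∈ interval 1 (2 * m ∸ 3)
<-sum∈interval {a} {b} {m} a<b b<m =
  ∈-interval⁺ (≤-trans (≤-trans z<s a<b) (m≤n+m b a)) (s≤s (m+n≤o⇒m≤o∸n (a + b) (begin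
    a + b + 3            ≡⟨ a+b+3≡[2+a]+[1+b] a b ⟩
    suc (suc a) + suc b  ≤⟨ +-mono-≤ (≤-trans (s≤s a<b) b<m) b<m ⟩
    m + m                ≡⟨ m+m≡2m m ⟩
    2 * m                ∎)))
  where
  open ≤-Reasoning
  a+b+3≡[2+a]+[1+b] : ∀ a b → a + b + 3 ≡ suc (suc a) + suc b
  a+b+3≡[2+a]+[1+b] = solve-∀

distinct-sum∈interval : ∀ {a b m} → a < m → b < m → a ≢ b → a + b ∈ interval 1 (2 * m ∸ 3)
distinct-sum∈interval {a} {b} {m} a<m b<m a≢b with <-cmp a b
... | tri< a<b _ _ = <-sum∈interval a<b b<m
... | tri≈ _ a≡b _ = ⊥-elim (a≢b a≡b)
... | tri> _ _ b<a = subst (_∈ interval 1 (2 * m ∸ 3)) (+-comm b a) (<-sum∈interval b<a a<m)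

sum<2j∸1 : ∀ {a b j} → a < j → b < j → a + b < 2 * j ∸ 1
sum<2j∸1 {a} {b} {j} a<j b<j = m+n≤o⇒m≤o∸n (suc (a + b)) (begin
  suc (a + b) + 1      ≡⟨ +-comm (suc (a + b)) 1 ⟩
  suc (suc (a + b))    ≡⟨ +-suc (suc a) b ⟨
  suc a + suc b        ≤⟨ +-mono-≤ a<j b<j ⟩
  j + j                ≡⟨ m+m≡2m j ⟩
  2 * j                ∎)
  where open ≤-Reasoning

[2j∸3]+[2j∸1]≡2[j+j]∸4 : ∀ {j} → 2 ≤ j → (2 * j ∸ 3) + (2 * j ∸ 1) ≡ 2 * (j + j) ∸ 4
[2j∸3]+[2j∸1]≡2[j+j]∸4 (s≤s (s≤s {n = i} _)) = begin
  (2 * (2 + i) ∸ 3) + (2 * (2 + i) ∸ 1)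
    ≡⟨ cong₂ _+_ (∸-≡ (1 + 2 * i) 3 (4+2i≡[1+2i]+3 i)) (∸-≡ (3 + 2 * i) 1 (4+2i≡[3+2i]+1 i)) ⟩
  (1 + 2 * i) + (3 + 2 * i)    ≡⟨ ∸-≡ _ 4 (8+4i≡[1+2i]+[3+2i]+4 i) ⟨
  2 * ((2 + i) + (2 + i)) ∸ 4  ∎
  where
  open ≡-Reasoning
  4+2i≡[1+2i]+3 : ∀ i → 2 * (2 + i) ≡ (1 + 2 * i) + 3
  4+2i≡[1+2i]+3 = solve-∀
  4+2i≡[3+2i]+1 : ∀ i → 2 * (2 + i) ≡ (3 + 2 * i) + 1
  4+2i≡[3+2i]+1 = solve-∀
  8+4i≡[1+2i]+[3+2i]+4 : ∀ i → 2 * ((2 + i) + (2 + i)) ≡ (1 + 2 * i) + (3 + 2 * i) + 4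
  8+4i≡[1+2i]+[3+2i]+4 = solve-∀

2[1+hq]≡q[h+h]+2 : ∀ h q → 2 * suc (h * q) ≡ q * (h + h) + 2
2[1+hq]≡q[h+h]+2 = solve-∀

parity : ∀ x → ∃ λ y → x ≡ y + y ⊎ x ≡ suc (y + y)
parity zero = 0 , inj₁ refl
parity (suc x) with parity x
... | y , inj₁ x≡2y = y , inj₂ (cong suc x≡2y)
... | y , inj₂ x≡1+2y = suc y , inj₁ (cong suc (trans x≡1+2y (sym (+-suc y y))))

odd-part : ∀ x → ∃₂ λ a o → suc x ≡ 2 ^ a * suc (o + o)
odd-part = <-rec _ step
  where
  step : ∀ x → (∀ {y} → y < x → ∃₂ λ a o → suc y ≡ 2 ^ a * suc (o + o)) →
    ∃₂ λ a o → suc x ≡ 2 ^ a * suc (o + o)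
  step x rec with parity (suc x)
  ... | y , inj₂ 1+x≡1+2y = 0 , y , trans 1+x≡1+2y (sym (*-identityˡ (suc (y + y))))
  ... | zero , inj₁ ()
  ... | suc y , inj₁ 1+x≡2+2y with rec (subst (y <_) (sym (suc-injective 1+x≡2+2y)) (m<m+n y z<s))
  ...   | a , o , 1+y≡2^a*o = suc a , o , (begin
    suc x                                       ≡⟨ 1+x≡2+2y ⟩
    suc y + suc y                               ≡⟨ cong₂ _+_ 1+y≡2^a*o 1+y≡2^a*o ⟩
    2 ^ a * suc (o + o) + 2 ^ a * suc (o + o)   ≡⟨ cong (2 ^ a * suc (o + o) +_) (+-identityʳ _) ⟨
    2 * (2 ^ a * suc (o + o))                   ≡⟨ *-assoc 2 (2 ^ a) (suc (o + o)) ⟨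
    2 ^ suc a * suc (o + o)                     ∎)
    where open ≡-Reasoning

-- The three constructions

initialSegment : ∀ {n m} {{_ : NonZero n}} → m ≤ n → Certificate n m (2 * m ∸ 3)
initialSegment {n} {m} m≤n = record
  { Member = _< m
  ; member? = _<? m
  ; nonMembers = interval m (n ∸ m)
  ; nonMembers-complete = λ {x} x<n x≮m →
      ∈-interval⁺ (≮⇒≥ x≮m) (subst (x <_) (sym (m+[n∸m]≡n m≤n)) x<n)
  ; m+nonMembers≤n = ≤-reflexive (trans (cong (m +_) (length-interval m (n ∸ m))) (m+[n∸m]≡n m≤n))
  ; sums = map (_% n) (interval 1 (2 * m ∸ 3))
  ; sums-complete = λ _ _ a<m b<m a≢b → ∈-map⁺ (_% n) (distinct-sum∈interval a<m b<m a≢b)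
  ; length-sums≤ℓ = ≤-reflexive (trans (length-map (_% n) (interval 1 (2 * m ∸ 3))) (length-interval 1 (2 * m ∸ 3)))
  }

module _ {n h j : ℕ} {{_ : NonZero n}} (h+h≡n : h + h ≡ n) (2≤j : 2 ≤ j) (j≤h : j ≤ h) where

  private
    Member : ℕ → Set
    Member x = x < j ⊎ (h ≤ x × x ∸ h < j)

    low middle gap sums : List ℕ
    low = interval 1 (2 * j ∸ 3)
    middle = interval h (2 * j ∸ 1)
    gap = interval j (h ∸ j)
    sums = map (_% n) (low ++ middle)

    x≡h+[x∸h] : ∀ {x} → h ≤ x → x ≡ h + (x ∸ h)
    x≡h+[x∸h] h≤x = sym (m+[n∸m]≡n h≤x)

    low+high∈sums : ∀ {a b} → a < j → b < j → (a + (h + b)) % n ∈ sums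
    low+high∈sums {a} {b} a<j b<j = ∈-map⁺ (_% n) (∈-++⁺ʳ low (subst (_∈ middle) (h+[a+b]≡a+[h+b] h a b)
      (∈-interval⁺ (m≤m+n h (a + b)) (+-monoʳ-< h (sum<2j∸1 a<j b<j)))))
      where
      h+[a+b]≡a+[h+b] : ∀ h a b → h + (a + b) ≡ a + (h + b)
      h+[a+b]≡a+[h+b] = solve-∀

    high+high≡low+low : ∀ {x y} → h ≤ x → h ≤ y → (x + y) % n ≡ ((x ∸ h) + (y ∸ h)) % n
    high+high≡low+low {x} {y} h≤x h≤y = begin
      (x + y) % n                              ≡⟨ cong₂ (λ x y → (x + y) % n) (x≡h+[x∸h] h≤x) (x≡h+[x∸h] h≤y) ⟩
      ((h + (x ∸ h)) + (h + (y ∸ h))) % n      ≡⟨ cong (_% n) ([h+a]+[h+b]≡a+b+[h+h] h (x ∸ h) (y ∸ h)) ⟩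
      ((x ∸ h) + (y ∸ h) + (h + h)) % n        ≡⟨ cong (λ z → ((x ∸ h) + (y ∸ h) + z) % n) h+h≡n ⟩
      ((x ∸ h) + (y ∸ h) + n) % n              ≡⟨ [m+n]%n≡m%n _ n ⟩
      ((x ∸ h) + (y ∸ h)) % n                  ∎
      where
      open ≡-Reasoning
      [h+a]+[h+b]≡a+b+[h+h] : ∀ h a b → (h + a) + (h + b) ≡ a + b + (h + h)
      [h+a]+[h+b]≡a+b+[h+h] = solve-∀

    sums-complete : ∀ {x y} → x < n → y < n → Member x → Member y → x ≢ y → (x + y) % n ∈ sums
    sums-complete _ _ (inj₁ x<j) (inj₁ y<j) x≢y =
      ∈-map⁺ (_% n) (∈-++⁺ˡ (distinct-sum∈interval x<j y<j x≢y))
    sums-complete {x} _ _ (inj₁ x<j) (inj₂ (h≤y , y∸h<j)) _ =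
      subst (λ y → (x + y) % n ∈ sums) (sym (x≡h+[x∸h] h≤y)) (low+high∈sums x<j y∸h<j)
    sums-complete {x} {y} _ _ (inj₂ (h≤x , x∸h<j)) (inj₁ y<j) _ =
      subst (λ z → z % n ∈ sums) (trans (+-comm y _) (cong (_+ y) (sym (x≡h+[x∸h] h≤x)))) (low+high∈sums y<j x∸h<j)
    sums-complete {x} {y} _ _ (inj₂ (h≤x , x∸h<j)) (inj₂ (h≤y , y∸h<j)) x≢y =
      subst (_∈ sums) (sym (high+high≡low+low h≤x h≤y))
        (∈-map⁺ (_% n) (∈-++⁺ˡ (distinct-sum∈interval x∸h<j y∸h<j λ x∸h≡y∸h →
          x≢y (trans (x≡h+[x∸h] h≤x) (trans (cong (h +_) x∸h≡y∸h) (sym (x≡h+[x∸h] h≤y)))))))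

    nonMembers-complete : ∀ {x} → x < n → ¬ Member x → x ∈ gap ++ map (h +_) gap
    nonMembers-complete {x} x<n x∉ with x <? h
    ... | yes x<h = ∈-++⁺ˡ (∈-interval⁺ (≮⇒≥ (x∉ ∘ inj₁)) (subst (x <_) (sym (m+[n∸m]≡n j≤h)) x<h))
    ... | no x≮h = ∈-++⁺ʳ gap (subst (_∈ map (h +_) gap) (sym (x≡h+[x∸h] h≤x))
          (∈-map⁺ (h +_) (∈-interval⁺ (≮⇒≥ (λ x∸h<j → x∉ (inj₂ (h≤x , x∸h<j)))) x∸h<j+[h∸j])))
      where
      h≤x : h ≤ x
      h≤x = ≮⇒≥ x≮h
      x∸h<j+[h∸j] : x ∸ h < j + (h ∸ j)
      x∸h<j+[h∸j] = subst (x ∸ h <_) (trans (m+n∸m≡n h h) (sym (m+[n∸m]≡n j≤h)))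
        (∸-monoˡ-< (subst (x <_) (sym h+h≡n) x<n) h≤x)

    m+nonMembers≡n : (j + j) + length (gap ++ map (h +_) gap) ≡ n
    m+nonMembers≡n = begin
      (j + j) + length (gap ++ map (h +_) gap)          ≡⟨ cong ((j + j) +_) (length-++ gap) ⟩
      (j + j) + (length gap + length (map (h +_) gap))  ≡⟨ cong (λ l → (j + j) + (length gap + l)) (length-map (h +_) gap) ⟩
      (j + j) + (length gap + length gap)               ≡⟨ cong (λ l → (j + j) + (l + l)) (length-interval j (h ∸ j)) ⟩
      (j + j) + ((h ∸ j) + (h ∸ j))                     ≡⟨ [j+j]+[d+d]≡[j+d]+[j+d] j (h ∸ j) ⟩
      (j + (h ∸ j)) + (j + (h ∸ j))                     ≡⟨ cong₂ _+_ (m+[n∸m]≡n j≤h) (m+[n∸m]≡n j≤h) ⟩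
      h + h                                             ≡⟨ h+h≡n ⟩
      n                                                 ∎
      where
      open ≡-Reasoning
      [j+j]+[d+d]≡[j+d]+[j+d] : ∀ j d → (j + j) + (d + d) ≡ (j + d) + (j + d)
      [j+j]+[d+d]≡[j+d]+[j+d] = solve-∀

    length-sums : length sums ≡ 2 * (j + j) ∸ 4
    length-sums = begin
      length sums                 ≡⟨ length-map (_% n) (low ++ middle) ⟩
      length (low ++ middle)      ≡⟨ length-++ low ⟩
      length low + length middle  ≡⟨ cong₂ _+_ (length-interval 1 (2 * j ∸ 3)) (length-interval h (2 * j ∸ 1)) ⟩
      (2 * j ∸ 3) + (2 * j ∸ 1)   ≡⟨ [2j∸3]+[2j∸1]≡2[j+j]∸4 2≤j ⟩
      2 * (j + j) ∸ 4             ∎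
      where open ≡-Reasoning

  twoIntervals : Certificate n (j + j) (2 * (j + j) ∸ 4)
  twoIntervals = record
    { Member = Member
    ; member? = λ x → (x <? j) ⊎-dec ((h ≤? x) ×-dec (x ∸ h <? j))
    ; nonMembers = gap ++ map (h +_) gap
    ; nonMembers-complete = nonMembers-complete
    ; m+nonMembers≤n = ≤-reflexive m+nonMembers≡n
    ; sums = sums
    ; sums-complete = sums-complete
    ; length-sums≤ℓ = ≤-reflexive length-sums
    }

module _ {N m ℓ} {N≢0 : NonZero N} (C : Certificate N {{N≢0}} m ℓ) (t : ℕ) {{_ : NonZero t}} where
  private instance _ = N≢0
  open Certificate C

  private
    instance
      t*N≢0 : NonZero (t * N)
      t*N≢0 = m*n≢0 t N
      N*t≢0 : NonZero (N * t)
      N*t≢0 = m*n≢0 N t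

    Multiple : ℕ → Set
    Multiple x = x % t ≡ 0 × Member (x / t)

    nonMultiples : List ℕ
    nonMultiples = blocks t (interval 1 (t ∸ 1)) N

    x/t<N : ∀ {x} → x < t * N → x / t < N
    x/t<N {x} x<tN = m<n*o⇒m/o<n (subst (x <_) (*-comm t N) x<tN)

    x≡x/t*t : ∀ {x} → x % t ≡ 0 → x ≡ x / t * t
    x≡x/t*t {x} x%t≡0 = trans (m≡m%n+[m/n]*n x t) (cong (_+ x / t * t) x%t≡0)

    nonMembers-complete′ : ∀ {x} → x < t * N → ¬ Multiple x → x ∈ nonMultiples ++ map (_* t) nonMembers
    nonMembers-complete′ {x} x<tN x∉ with x % t ≟ 0
    ... | no x%t≢0 = ∈-++⁺ˡ (subst (_∈ nonMultiples) (sym (m≡m%n+[m/n]*n x t))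
          (∈-blocks⁺ (∈-interval⁺ (n≢0⇒n>0 x%t≢0) x%t<1+[t∸1]) (x/t<N x<tN)))
      where
      x%t<1+[t∸1] : x % t < 1 + (t ∸ 1)
      x%t<1+[t∸1] = subst (x % t <_) (sym (m+[n∸m]≡n (>-nonZero⁻¹ t))) (m%n<n x t)
    ... | yes x%t≡0 = ∈-++⁺ʳ nonMultiples (subst (_∈ map (_* t) nonMembers) (sym (x≡x/t*t x%t≡0))
          (∈-map⁺ (_* t) (nonMembers-complete (x/t<N x<tN) (λ x/t∈ → x∉ (x%t≡0 , x/t∈)))))

    m+nonMembers′≤tN : m + length (nonMultiples ++ map (_* t) nonMembers) ≤ t * N
    m+nonMembers′≤tN = begin
      m + length (nonMultiples ++ map (_* t) nonMembers)
        ≡⟨ cong (m +_) (trans (length-++ nonMultiples) (cong₂ _+_ (length-blocks t _ N) (length-map (_* t) nonMembers))) ⟩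
      m + (N * length (interval 1 (t ∸ 1)) + length nonMembers)
        ≡⟨ cong (λ l → m + (N * l + length nonMembers)) (length-interval 1 (t ∸ 1)) ⟩
      m + (N * (t ∸ 1) + length nonMembers)   ≡⟨ x+[y+z]≡y+[x+z] m (N * (t ∸ 1)) (length nonMembers) ⟩
      N * (t ∸ 1) + (m + length nonMembers)   ≤⟨ +-monoʳ-≤ (N * (t ∸ 1)) m+nonMembers≤n ⟩
      N * (t ∸ 1) + N                         ≡⟨ Nu+N≡[1+u]N N (t ∸ 1) ⟩
      (1 + (t ∸ 1)) * N                       ≡⟨ cong (_* N) (m+[n∸m]≡n (>-nonZero⁻¹ t)) ⟩
      t * N                                   ∎
      where
      open ≤-Reasoning
      x+[y+z]≡y+[x+z] : ∀ x y z → x + (y + z) ≡ y + (x + z)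
      x+[y+z]≡y+[x+z] = solve-∀
      Nu+N≡[1+u]N : ∀ N u → N * u + N ≡ (1 + u) * N
      Nu+N≡[1+u]N = solve-∀

    x+y%tN≡[x/t+y/t]%N*t : ∀ {x y} → x % t ≡ 0 → y % t ≡ 0 → (x + y) % (t * N) ≡ (x / t + y / t) % N * t
    x+y%tN≡[x/t+y/t]%N*t {x} {y} x%t≡0 y%t≡0 = begin
      (x + y) % (t * N)                 ≡⟨ cong₂ (λ a b → (a + b) % (t * N)) (x≡x/t*t x%t≡0) (x≡x/t*t y%t≡0) ⟩
      (x / t * t + y / t * t) % (t * N) ≡⟨ cong (_% (t * N)) (*-distribʳ-+ t (x / t) (y / t)) ⟨
      (x / t + y / t) * t % (t * N)     ≡⟨ %-congʳ (*-comm t N) ⟩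
      (x / t + y / t) * t % (N * t)     ≡⟨ m%n*o≡m*o%[n*o] (x / t + y / t) N t ⟨
      (x / t + y / t) % N * t           ∎
      where open ≡-Reasoning

    sums-complete′ : ∀ {x y} → x < t * N → y < t * N → Multiple x → Multiple y → x ≢ y →
      (x + y) % (t * N) ∈ map (_* t) sums
    sums-complete′ {x} {y} x<tN y<tN (x%t≡0 , x/t∈) (y%t≡0 , y/t∈) x≢y =
      subst (_∈ map (_* t) sums) (sym (x+y%tN≡[x/t+y/t]%N*t x%t≡0 y%t≡0)) (∈-map⁺ (_* t)
        (sums-complete (x/t<N x<tN) (x/t<N y<tN) x/t∈ y/t∈ λ x/t≡y/t →
          x≢y (trans (x≡x/t*t x%t≡0) (trans (cong (_* t) x/t≡y/t) (sym (x≡x/t*t y%t≡0))))))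

  scale : Certificate (t * N) m ℓ
  scale = record
    { Member = Multiple
    ; member? = λ x → (x % t ≟ 0) ×-dec member? (x / t)
    ; nonMembers = nonMultiples ++ map (_* t) nonMembers
    ; nonMembers-complete = nonMembers-complete′
    ; m+nonMembers≤n = m+nonMembers′≤tN
    ; sums = map (_* t) sums
    ; sums-complete = sums-complete′
    ; length-sums≤ℓ = ≤-trans (≤-reflexive (length-map (_* t) sums)) length-sums≤ℓ
    }

-- With q = 2p + 1, s = 2h and N = qs, write y < N as y = r + js with r < s and j < q. The set
-- consists of the y with h < r, with r = h and j ≤ p, and with r = 0 and j ∈ {0} ∪ (p, 2p].
-- If y + z ≡ 0 or s (mod N), then the residues are both 0 or both h, and the columns then agree.
module _ (h p : ℕ) .{{_ : NonZero h}} .{{_ : NonZero p}} where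

  private
    q s N : ℕ
    q = suc (p + p)
    s = h + h
    N = q * s

    instance
      s≢0 : NonZero s
      s≢0 = >-nonZero (≤-trans (>-nonZero⁻¹ h) (m≤m+n h h))
      N≢0 : NonZero N
      N≢0 = m*n≢0 q s

    Admissible : ℕ → ℕ → Set
    Admissible r j = (r ≡ 0 × (j ≡ 0 ⊎ p < j)) ⊎ (h < r ⊎ (r ≡ h × j ≤ p))

    Member : ℕ → Set
    Member y = Admissible (y % s) (y / s)

    decompose : ∀ y → y ≡ y % s + y / s * s
    decompose y = m≡m%n+[m/n]*n y s

    column<q : ∀ {y} → y < N → y / s < q
    column<q y<N = m<n*o⇒m/o<n {n = q} {o = s} y<N

    residue-shape : ∀ {r j} → Admissible r j → r ≡ 0 ⊎ h ≤ r
    residue-shape (inj₁ (r≡0 , _)) = inj₁ r≡0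
    residue-shape (inj₂ (inj₁ h<r)) = inj₂ (<⇒≤ h<r)
    residue-shape (inj₂ (inj₂ (r≡h , _))) = inj₂ (≤-reflexive (sym r≡h))

    zero-column : ∀ {j} → Admissible 0 j → j ≡ 0 ⊎ p < j
    zero-column (inj₁ (_ , j≡0⊎p<j)) = j≡0⊎p<j
    zero-column (inj₂ (inj₁ ()))
    zero-column (inj₂ (inj₂ (0≡h , _))) = ⊥-elim (≢-nonZero⁻¹ h (sym 0≡h))

    half-column : ∀ {j} → Admissible h j → j ≤ p
    half-column (inj₁ (h≡0 , _)) = ⊥-elim (≢-nonZero⁻¹ h h≡0)
    half-column (inj₂ (inj₁ h<h)) = ⊥-elim (<-irrefl refl h<h)
    half-column (inj₂ (inj₂ (_ , j≤p))) = j≤p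

    residues : ∀ {a b} → a < s → b < s → a ≡ 0 ⊎ h ≤ a → b ≡ 0 ⊎ h ≤ b → a + b ≡ 0 ⊎ a + b ≡ s + 0 →
      (a ≡ 0 × b ≡ 0) ⊎ (a ≡ h × b ≡ h)
    residues {a} _ _ _ _ (inj₁ a+b≡0) = inj₁ (m+n≡0⇒m≡0 a a+b≡0 , m+n≡0⇒n≡0 a a+b≡0)
    residues _ b<s (inj₁ refl) _ (inj₂ b≡s+0) = ⊥-elim (<-irrefl (trans b≡s+0 (+-identityʳ s)) b<s)
    residues {a} a<s _ (inj₂ _) (inj₁ refl) (inj₂ a+0≡s+0) = ⊥-elim (<-irrefl (+-cancelʳ-≡ 0 a s a+0≡s+0) a<s)
    residues _ _ (inj₂ h≤a) (inj₂ h≤b) (inj₂ a+b≡s+0) =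
      inj₂ (≥-pinch h≤a h≤b (≤-reflexive (trans a+b≡s+0 (+-identityʳ s))))

    p<x⇒x≰1 : ∀ {x} → p < x → ¬ x ≤ 1
    p<x⇒x≰1 p<x x≤1 = <⇒≱ (>-nonZero⁻¹ p) (≤-pred (≤-trans p<x x≤1))

    large-column∉sums : ∀ {b ε} → p < b → b < q → ε ≤ 1 → ¬ (b ≡ ε ⊎ b ≡ q + ε)
    large-column∉sums p<b _ ε≤1 (inj₁ b≡ε) = p<x⇒x≰1 p<b (≤-trans (≤-reflexive b≡ε) ε≤1)
    large-column∉sums _ b<q _ (inj₂ b≡q+ε) = <⇒≱ b<q (≤-trans (m≤m+n q _) (≤-reflexive (sym b≡q+ε)))

    zero-columns : ∀ {a b ε} → a < q → b < q → a ≡ 0 ⊎ p < a → b ≡ 0 ⊎ p < b → ε ≤ 1 →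
      a + b ≡ ε ⊎ a + b ≡ q + ε → a ≡ b
    zero-columns _ _ (inj₁ refl) (inj₁ refl) _ _ = refl
    zero-columns _ b<q (inj₁ refl) (inj₂ p<b) ε≤1 b≡ε⊎q+ε = ⊥-elim (large-column∉sums p<b b<q ε≤1 b≡ε⊎q+ε)
    zero-columns {a} {ε = ε} a<q _ (inj₂ p<a) (inj₁ refl) ε≤1 a+0≡ε⊎q+ε =
      ⊥-elim (large-column∉sums p<a a<q ε≤1 (subst (λ x → x ≡ ε ⊎ x ≡ q + ε) (+-identityʳ a) a+0≡ε⊎q+ε))
    zero-columns {a} {b} _ _ (inj₂ p<a) (inj₂ _) ε≤1 (inj₁ a+b≡ε) =
      ⊥-elim (p<x⇒x≰1 p<a (≤-trans (m≤m+n a b) (≤-trans (≤-reflexive a+b≡ε) ε≤1)))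
    zero-columns {a} {b} {ε} _ _ (inj₂ p<a) (inj₂ p<b) ε≤1 (inj₂ a+b≡q+ε) =
      let a≡1+p , b≡1+p = ≥-pinch p<a p<b a+b≤2+2p in trans a≡1+p (sym b≡1+p)
      where
      a+b≤2+2p : a + b ≤ suc p + suc p
      a+b≤2+2p = ≤-trans (≤-reflexive a+b≡q+ε) (≤-trans (+-monoʳ-≤ q ε≤1) (≤-reflexive (cong suc (trans (+-assoc p p 1) (cong (p +_) (+-comm p 1))))))

    half-columns : ∀ {a b ε} → a ≤ p → b ≤ p → ε ≤ 1 → suc (a + b) ≡ ε ⊎ suc (a + b) ≡ q + ε → a ≡ b
    half-columns {a} {b} _ _ ε≤1 (inj₁ 1+a+b≡ε) = trans (m+n≡0⇒m≡0 a a+b≡0) (sym (m+n≡0⇒n≡0 a a+b≡0))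
      where
      a+b≡0 : a + b ≡ 0
      a+b≡0 = n≤0⇒n≡0 (≤-pred (≤-trans (≤-reflexive 1+a+b≡ε) ε≤1))
    half-columns {a} {b} {ε} a≤p b≤p _ (inj₂ 1+a+b≡q+ε) =
      let a≡p , b≡p = ≤-pinch a≤p b≤p (≤-pred (≤-trans (m≤m+n q ε) (≤-reflexive (sym 1+a+b≡q+ε))))
      in trans a≡p (sym b≡p)

    collision : ∀ {y z ε} → y < N → z < N → Member y → Member z → ε ≤ 1 → (y + z) % N ≡ ε * s → y ≡ z
    collision {y} {z} {ε} y<N z<N y∈ z∈ ε≤1 y+z%N≡εs =
      conclude (residues (m%n<n y s) (m%n<n z s) (residue-shape y∈) (residue-shape z∈)
        (m<n+n∧m%n≡r⇒m≡r⊎m≡n+r (+-mono-< (m%n<n y s) (m%n<n z s)) ry+rz%s≡0))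
      where
      open ≡-Reasoning
      ry jy rz jz K : ℕ
      ry = y % s
      jy = y / s
      rz = z % s
      jz = z / s
      K = (y + z) / N

      y+z≡[ε+Kq]s : y + z ≡ (ε + K * q) * s
      y+z≡[ε+Kq]s = begin
        y + z                  ≡⟨ m≡m%n+[m/n]*n (y + z) N ⟩
        (y + z) % N + K * N    ≡⟨ cong (_+ K * N) y+z%N≡εs ⟩
        ε * s + K * (q * s)    ≡⟨ εs+Kqs≡[ε+Kq]s ε K q s ⟩
        (ε + K * q) * s        ∎
        where
        εs+Kqs≡[ε+Kq]s : ∀ ε K q s → ε * s + K * (q * s) ≡ (ε + K * q) * s
        εs+Kqs≡[ε+Kq]s = solve-∀

      y+z≡[ry+rz]+[jy+jz]s : y + z ≡ (ry + rz) + (jy + jz) * s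
      y+z≡[ry+rz]+[jy+jz]s = begin
        y + z                          ≡⟨ cong₂ _+_ (decompose y) (decompose z) ⟩
        (ry + jy * s) + (rz + jz * s)  ≡⟨ [a+cs]+[b+ds]≡[a+b]+[c+d]s ry rz jy jz s ⟩
        (ry + rz) + (jy + jz) * s      ∎
        where
        [a+cs]+[b+ds]≡[a+b]+[c+d]s : ∀ a b c d s → (a + c * s) + (b + d * s) ≡ (a + b) + (c + d) * s
        [a+cs]+[b+ds]≡[a+b]+[c+d]s = solve-∀

      ry+rz%s≡0 : (ry + rz) % s ≡ 0
      ry+rz%s≡0 = begin
        (ry + rz) % s                      ≡⟨ [m+kn]%n≡m%n (ry + rz) (jy + jz) s ⟨
        ((ry + rz) + (jy + jz) * s) % s    ≡⟨ cong (_% s) (trans (sym y+z≡[ry+rz]+[jy+jz]s) y+z≡[ε+Kq]s) ⟩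
        (ε + K * q) * s % s                ≡⟨ m*n%n≡0 (ε + K * q) s ⟩
        0                                  ∎

      columns : ∀ {u} → u * s ≡ y + z → u < q + q → u ≡ ε ⊎ u ≡ q + ε
      columns {u} us≡y+z u<2q = m<n+n∧m%n≡r⇒m≡r⊎m≡n+r u<2q (begin
        u % q              ≡⟨ cong (_% q) (*-cancelʳ-≡ u (ε + K * q) s (trans us≡y+z y+z≡[ε+Kq]s)) ⟩
        (ε + K * q) % q    ≡⟨ [m+kn]%n≡m%n ε K q ⟩
        ε % q              ≡⟨ m<n⇒m%n≡m (s≤s (≤-trans ε≤1 (≤-trans (>-nonZero⁻¹ p) (m≤m+n p p)))) ⟩
        ε                  ∎)

      rr+[jy+jz]s≡y+z : ∀ {r} → ry ≡ r → rz ≡ r → r + r + (jy + jz) * s ≡ y + z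
      rr+[jy+jz]s≡y+z ry≡r rz≡r = sym (trans y+z≡[ry+rz]+[jy+jz]s (cong₂ (λ a b → a + b + (jy + jz) * s) ry≡r rz≡r))

      same-decomposition : ∀ {r} → ry ≡ r → rz ≡ r → jy ≡ jz → y ≡ z
      same-decomposition ry≡r rz≡r jy≡jz = begin
        y              ≡⟨ decompose y ⟩
        ry + jy * s    ≡⟨ cong₂ (λ r j → r + j * s) (trans ry≡r (sym rz≡r)) jy≡jz ⟩
        rz + jz * s    ≡⟨ decompose z ⟨
        z              ∎

      conclude : (ry ≡ 0 × rz ≡ 0) ⊎ (ry ≡ h × rz ≡ h) → y ≡ z
      conclude (inj₁ (ry≡0 , rz≡0)) = same-decomposition ry≡0 rz≡0
        (zero-columns (column<q y<N) (column<q z<N) (zero-column (subst (λ r → Admissible r jy) ry≡0 y∈))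
          (zero-column (subst (λ r → Admissible r jz) rz≡0 z∈)) ε≤1
          (columns (rr+[jy+jz]s≡y+z ry≡0 rz≡0) (+-mono-< (column<q y<N) (column<q z<N))))
      conclude (inj₂ (ry≡h , rz≡h)) = same-decomposition ry≡h rz≡h
        (half-columns jy≤p jz≤p ε≤1
          (columns (rr+[jy+jz]s≡y+z ry≡h rz≡h) (≤-<-trans (s≤s (+-mono-≤ jy≤p jz≤p)) (m<m+n q z<s))))
        where
        jy≤p = half-column (subst (λ r → Admissible r jy) ry≡h y∈)
        jz≤p = half-column (subst (λ r → Admissible r jz) rz≡h z∈)

    s<N : s < N
    s<N = m<m+n s (*-mono-≤ {1} {p + p} {1} {s} (≤-trans (>-nonZero⁻¹ p) (m≤m+n p p)) (>-nonZero⁻¹ s))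

    sums : List ℕ
    sums = interval 1 (s ∸ 1) ++ interval (suc s) (N ∸ suc s)

    sums-complete : ∀ {y z} → y < N → z < N → Member y → Member z → y ≢ z → (y + z) % N ∈ sums
    sums-complete {y} {z} y<N z<N y∈ z∈ y≢z with <-cmp ((y + z) % N) s
    ... | tri< w<s _ _ = ∈-++⁺ˡ (∈-interval⁺ (n≢0⇒n>0 (y≢z ∘ collision y<N z<N y∈ z∈ z≤n))
          (subst ((y + z) % N <_) (sym (m+[n∸m]≡n (>-nonZero⁻¹ s))) w<s))
    ... | tri≈ _ w≡s _ = ⊥-elim (y≢z (collision y<N z<N y∈ z∈ ≤-refl (trans w≡s (sym (*-identityˡ s)))))
    ... | tri> _ _ s<w = ∈-++⁺ʳ (interval 1 (s ∸ 1))
          (∈-interval⁺ s<w (subst ((y + z) % N <_) (sym (m+[n∸m]≡n s<N)) (m%n<n (y + z) N)))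

    length-sums : length sums ≡ 2 * suc (h * q) ∸ 4
    length-sums = begin
      length sums
        ≡⟨ length-++ (interval 1 (s ∸ 1)) ⟩
      length (interval 1 (s ∸ 1)) + length (interval (suc s) (N ∸ suc s))
        ≡⟨ cong₂ _+_ (length-interval 1 (s ∸ 1)) (length-interval (suc s) (N ∸ suc s)) ⟩
      (s ∸ 1) + (N ∸ suc s)
        ≡⟨ ∸-≡ _ 4 2+2hq≡[s∸1]+[N∸1+s]+4 ⟨
      2 * suc (h * q) ∸ 4
        ∎
      where
      open ≡-Reasoning
      2+2hq≡[s∸1]+[N∸1+s]+4 : 2 * suc (h * q) ≡ (s ∸ 1) + (N ∸ suc s) + 4
      2+2hq≡[s∸1]+[N∸1+s]+4 = begin
        2 * suc (h * q)                        ≡⟨ 2[1+hq]≡q[h+h]+2 h q ⟩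
        N + 2                                  ≡⟨ cong (_+ 2) (m+[n∸m]≡n s<N) ⟨
        suc s + (N ∸ suc s) + 2                ≡⟨ cong (λ x → suc x + (N ∸ suc s) + 2) (m+[n∸m]≡n (>-nonZero⁻¹ s)) ⟨
        suc (1 + (s ∸ 1)) + (N ∸ suc s) + 2    ≡⟨ [2+a]+d+2≡a+d+4 (s ∸ 1) (N ∸ suc s) ⟩
        (s ∸ 1) + (N ∸ suc s) + 4              ∎
        where
        [2+a]+d+2≡a+d+4 : ∀ a d → suc (1 + a) + d + 2 ≡ a + d + 4
        [2+a]+d+2≡a+d+4 = solve-∀

    partialColumns zeroColumn halfColumn nonMembers : List ℕ
    partialColumns = blocks s (interval 1 (h ∸ 1)) q
    zeroColumn = map (_* s) (interval 1 p)
    halfColumn = map (λ j → h + j * s) (interval (suc p) p)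
    nonMembers = partialColumns ++ zeroColumn ++ halfColumn

    nonMembers-complete : ∀ {y} → y < N → ¬ Member y → y ∈ nonMembers
    nonMembers-complete {y} y<N y∉ =
      subst (_∈ nonMembers) (sym (decompose y)) (inadmissible∈nonMembers (column<q y<N) y∉)
      where
      inadmissible∈nonMembers : ∀ {r j} → j < q → ¬ Admissible r j → r + j * s ∈ nonMembers
      inadmissible∈nonMembers {r} {j} j<q ¬adm with r ≟ 0 | r ≟ h
      ... | yes refl | _ = ∈-++⁺ʳ partialColumns (∈-++⁺ˡ (∈-map⁺ (_* s)
            (∈-interval⁺ (n≢0⇒n>0 (λ j≡0 → ¬adm (inj₁ (refl , inj₁ j≡0))))
              (s≤s (≮⇒≥ (λ p<j → ¬adm (inj₁ (refl , inj₂ p<j))))))))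
      ... | no _ | yes refl = ∈-++⁺ʳ partialColumns (∈-++⁺ʳ zeroColumn (∈-map⁺ (λ j → h + j * s)
            (∈-interval⁺ (≰⇒> (λ j≤p → ¬adm (inj₂ (inj₂ (refl , j≤p))))) j<q)))
      ... | no r≢0 | no r≢h = ∈-++⁺ˡ (∈-blocks⁺ (∈-interval⁺ (n≢0⇒n>0 r≢0) r<1+[h∸1]) j<q)
        where
        r<1+[h∸1] : r < 1 + (h ∸ 1)
        r<1+[h∸1] = subst (r <_) (sym (m+[n∸m]≡n (>-nonZero⁻¹ h)))
          (≤∧≢⇒< (≮⇒≥ (λ h<r → ¬adm (inj₂ (inj₁ h<r)))) r≢h)

    m+nonMembers≡N : suc (h * q) + length nonMembers ≡ N
    m+nonMembers≡N = begin
      suc (h * q) + length nonMembers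
        ≡⟨ cong (suc (h * q) +_) (trans (length-++ partialColumns) (cong (length partialColumns +_) (length-++ zeroColumn))) ⟩
      suc (h * q) + (length partialColumns + (length zeroColumn + length halfColumn))
        ≡⟨ cong (λ l → suc (h * q) + (l + (length zeroColumn + length halfColumn)))
             (trans (length-blocks s (interval 1 (h ∸ 1)) q) (cong (q *_) (length-interval 1 (h ∸ 1)))) ⟩
      suc (h * q) + (q * (h ∸ 1) + (length zeroColumn + length halfColumn))
        ≡⟨ cong₂ (λ a b → suc (h * q) + (q * (h ∸ 1) + (a + b)))
             (trans (length-map (_* s) (interval 1 p)) (length-interval 1 p))
             (trans (length-map (λ j → h + j * s) (interval (suc p) p)) (length-interval (suc p) p)) ⟩
      suc (h * q) + (q * (h ∸ 1) + (p + p))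
        ≡⟨ cong (λ x → suc (x * q) + (q * (h ∸ 1) + (p + p))) (m+[n∸m]≡n (>-nonZero⁻¹ h)) ⟨
      suc ((1 + (h ∸ 1)) * q) + (q * (h ∸ 1) + (p + p))
        ≡⟨ sizes-add-up (h ∸ 1) p ⟩
      q * ((1 + (h ∸ 1)) + (1 + (h ∸ 1)))
        ≡⟨ cong (λ x → q * (x + x)) (m+[n∸m]≡n (>-nonZero⁻¹ h)) ⟩
      N ∎
      where
      open ≡-Reasoning
      sizes-add-up : ∀ a p → suc ((1 + a) * suc (p + p)) + (suc (p + p) * a + (p + p)) ≡ suc (p + p) * ((1 + a) + (1 + a))
      sizes-add-up = solve-∀

  oddFactor : Certificate N (suc (h * q)) (2 * suc (h * q) ∸ 4)
  oddFactor = record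
    { Member = Member
    ; member? = λ y → let r = y % s ; j = y / s in
        ((r ≟ 0) ×-dec ((j ≟ 0) ⊎-dec (p <? j))) ⊎-dec ((h <? r) ⊎-dec ((r ≟ h) ×-dec (j ≤? p)))
    ; nonMembers = nonMembers
    ; nonMembers-complete = nonMembers-complete
    ; m+nonMembers≤n = ≤-reflexive m+nonMembers≡N
    ; sums = sums
    ; sums-complete = sums-complete
    ; length-sums≤ℓ = ≤-reflexive length-sums
    }

ρ^≤2m∸4-even : ∀ {n m} {{_ : NonZero n}} → 3 ≤ m → m ≤ n → 2 ∣ n → 2 ∣ m → ρ^ n m ≤ 2 * m ∸ 4
ρ^≤2m∸4-even {n} {m} 3≤m m≤n (divides h n≡h*2) (divides j m≡j*2) =
  subst (λ m → ρ^ n m ≤ 2 * m ∸ 4) (sym m≡j+j) (ρ^≤ℓ (twoIntervals h+h≡n 2≤j j≤h))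
  where
  x*2≡x+x : ∀ x → x * 2 ≡ x + x
  x*2≡x+x = solve-∀
  m≡j+j : m ≡ j + j
  m≡j+j = trans m≡j*2 (x*2≡x+x j)
  h+h≡n : h + h ≡ n
  h+h≡n = sym (trans n≡h*2 (x*2≡x+x h))
  2≤j : 2 ≤ j
  2≤j = ≮⇒≥ λ j<2 → <⇒≱ 3≤m (subst (_≤ 2) (sym m≡j+j) (+-mono-≤ (≤-pred j<2) (≤-pred j<2)))
  j≤h : j ≤ h
  j≤h = ≮⇒≥ λ h<j → <⇒≱ (+-mono-< h<j h<j) (subst₂ _≤_ m≡j+j (sym h+h≡n) m≤n)

ρ^≤2m∸4-oddFactor : ∀ {n m} {{_ : NonZero n}} → 3 ≤ m → (2 * m ∸ 2) ∣ n → ¬ (∃ λ k → m ≡ 2 ^ k + 1) →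
  ρ^ n m ≤ 2 * m ∸ 4
ρ^≤2m∸4-oddFactor {n} _ (divides zero n≡0) _ = ⊥-elim (≢-nonZero⁻¹ n n≡0)
ρ^≤2m∸4-oddFactor {n} (s≤s (s≤s (s≤s {n = x} _))) (divides (suc t) n≡[1+t][2m∸2]) m≢2^k+1
  with odd-part (suc x)
... | a , zero , 2+x≡2^a = ⊥-elim (m≢2^k+1 (a , trans (cong suc (trans 2+x≡2^a (*-identityʳ (2 ^ a)))) (+-comm 1 (2 ^ a))))
... | a , suc p , 2+x≡2^a*q =
  subst₂ (λ n m → ρ^ n m ≤ 2 * m ∸ 4) (sym n≡[1+t]N) (sym m≡1+hq) (ρ^≤ℓ (scale (oddFactor h (suc p)) (suc t)))
  where
  h = 2 ^ a
  q = suc (suc p + suc p)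
  instance
    h≢0 : NonZero h
    h≢0 = m^n≢0 2 a
  m≡1+hq : suc (suc (suc x)) ≡ suc (h * q)
  m≡1+hq = cong suc 2+x≡2^a*q
  n≡[1+t]N : n ≡ suc t * (q * (h + h))
  n≡[1+t]N = trans n≡[1+t][2m∸2]
    (cong (suc t *_) (trans (cong (λ m → 2 * m ∸ 2) m≡1+hq) (∸-≡ _ 2 (2[1+hq]≡q[h+h]+2 h q))))

corollary4p1 : (n m : ℕ) → 3 ≤ m → m ≤ n →
    ((((2 ∣ n) × (2 ∣ m)) ⊎ (((2 * m ∸ 2) ∣ n) × ¬ (∃ λ k → m ≡ 2 ^ k + 1)))
      → ρ^ n m ≤ ρ n m ⊓ (2 * m ∸ 4))
    × (¬ (((2 ∣ n) × (2 ∣ m)) ⊎ (((2 * m ∸ 2) ∣ n) × ¬ (∃ λ k → m ≡ 2 ^ k + 1)))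
      → ρ^ n m ≤ ρ n m ⊓ (2 * m ∸ 3))
corollary4p1 n m 3≤m m≤n =
  (λ condition → ⊓-glb (ρ^≤ρ n m) (ρ^≤2m∸4 condition)) ,
  (λ _ → ⊓-glb (ρ^≤ρ n m) (ρ^≤ℓ (initialSegment m≤n)))
  where
  instance
    n≢0 : NonZero n
    n≢0 = >-nonZero (≤-trans (s≤s z≤n) (≤-trans 3≤m m≤n))
  ρ^≤2m∸4 : ((2 ∣ n) × (2 ∣ m)) ⊎ (((2 * m ∸ 2) ∣ n) × ¬ (∃ λ k → m ≡ 2 ^ k + 1)) → ρ^ n m ≤ 2 * m ∸ 4
  ρ^≤2m∸4 (inj₁ (2∣n , 2∣m)) = ρ^≤2m∸4-even 3≤m m≤n 2∣n 2∣m
  ρ^≤2m∸4 (inj₂ ([2m∸2]∣n , m≢2^k+1)) = ρ^≤2m∸4-oddFactor 3≤m [2m∸2]∣n m≢2^k+1
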